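{- Let $N=(S,A,T,I)$ be a finite PTI net. Then: (1) the identity relation $\mathcal{I}_S=\{(s,s)\mid s\in S\}$ is a pti-place bisimulation; (2) if $R$ is a pti-place bisimulation, then its inverse $R^{ -1}=\{(s',s)\mid (s,s')\in R\}$ is a pti-place bisimulation; (3) if $R_1$ and $R_2$ are pti-place bisimulations, then their composition $R_1\circ R_2=\{(s,s'')\mid \exists s'.\,(s,s')\in R_1\wedge (s',s'')\in R_2\}$ is a pti-place bisimulation.
   Context: Multisets over a finite set $S$ are functions $m:S\to\mathbb{N}$; $\mathcal{M}(S)$ is the set of all of them, $\theta$ is the empty multiset, $m\subseteq m'$ means $m(s)\le m'(s)$ for all $s$, $(m\oplus m')(s)=m(s)+m'(s)$, $(m\ominus m')(s)=\max\{m(s)-m'(s),0\}$, $\mathit{dom}(m)=\{s\mid m(s)\neq 0\}$, and a place $s$ also denotes the multiset containing only $s$ once. A finite PTI net is $N=(S,A,T,I)$ with $S$ a finite set of places, $A$ a finite set of labels, $T\subseteq(\mathcal{M}(S)\setminus\{\theta\})\times A\times(\mathcal{M}(S)\setminus\{\theta\})$ a finite set of transitions, and $I\subseteq S\times T$ the inhibiting relation. For $t=(m,\ell,m')$ write ${}^\bullet t=m$, $l(t)=\ell$, $t^\bullet=m'$, and ${}^\circ t=\{s\in S\mid (s,t)\in I\}$. A transition $t$ is enabled at marking $m$, written $m[t\rangle$, if ${}^\bullet t\subseteq m$ and ${}^\circ t\cap\mathit{dom}(m)=\emptyset$; firing gives $m[t\rangle m'$ with $m'=(m\ominus {}^\bullet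 t)\oplus t^\bullet$. For $R\subseteq S\times S$, the additive closure $R^\oplus$ is the least relation on $\mathcal{M}(S)$ with $(\theta,\theta)\in R^\oplus$ and, if $(s_1,s_2)\in R$ and $(m_1,m_2)\in R^\oplus$, then $(s_1\oplus m_1,s_2\oplus m_2)\in R^\oplus$. A pti-place bisimulation is a relation $R\subseteq S\times S$ such that whenever $(m_1,m_2)\in R^\oplus$: (1) for every $t_1$ with $m_1[t_1\rangle m_1'$ there is $t_2$ with $m_2[t_2\rangle m_2'$ such that (a) $({}^\bullet t_1,{}^\bullet t_2)\in R^\oplus$, $(t_1^\bullet,t_2^\bullet)\in R^\oplus$, $l(t_1)=l(t_2)$ and $(m_1\ominus{}^\bullet t_1, m_2\ominus{}^\bullet t_2)\in R^\oplus$, and (b) for all $(s,s')\in R$: $s\in{}^\circ t_1\iff s'\in{}^\circ t_2$; (2) symmetrically, for every $t_2$ with $m_2[t_2\rangle m_2'$ there is $t_1$ with $m_1[t_1\rangle m_1'$ satisfying (a) and (b). -}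

module Defs where

open import Data.Nat using (ℕ; zero; suc; _+_; _∸_; _≤_)
open import Data.Fin using (Fin; _≟_)
open import Data.Vec using (Vec; lookup; zipWith; replicate; tabulate)
open import Data.Product using (Σ; _×_; _,_; ∃)
open import Relation.Binary.PropositionalEquality using (_≡_; _≢_)
open import Relation.Nullary using (yes; no)
open import Function.Bundles using (_⇔_)

MSet : ℕ → Set
MSet n = Vec ℕ n

θ : ∀ {n} → MSet n
θ = replicate _ 0

_⊕_ : ∀ {n} → MSet n → MSet n → MSet n
_⊕_ = zipWith _+_

_⊖_ : ∀ {n} → MSet n → MSet n → MSet n
_⊖_ = zipWith _∸_

_⊆_ : ∀ {n} → MSet n → MSet n → Set
m ⊆ m' = ∀ s → lookup m s ≤ lookup m' s

⟦_⟧ : ∀ {n} → Fin n → MSet n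
⟦ s ⟧ = tabulate (λ s' → help s s')
  where
  help : ∀ {n} → Fin n → Fin n → ℕ
  help s s' with s ≟ s'
  ... | yes _ = 1
  ... | no  _ = 0

NonEmpty : ∀ {n} → MSet n → Set
NonEmpty m = ∃ λ s → lookup m s ≢ 0

-- Finite PTI net: places Fin nS, labels Fin nA, transitions Fin nT
-- (each transition t is the triple (pre t , label t , post t), distinct
-- indices give distinct triples), inhibiting relation inh ⊆ S × T.
record PTINet : Set₁ where
  field
    nS nA nT : ℕ
    pre  : Fin nT → MSet nS
    label : Fin nT → Fin nA
    post : Fin nT → MSet nS
    pre-nonempty  : ∀ t → NonEmpty (pre t)
    post-nonempty : ∀ t → NonEmpty (post t)
    triple-injective : ∀ t t' → pre t ≡ pre t' → label t ≡ label t' → post t ≡ post t' → t ≡ t'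
    inh : Fin nS → Fin nT → Set

module _ (N : PTINet) where
  open PTINet N

  Place = Fin nS
  Trans = Fin nT

  PRel : Set₁
  PRel = Place → Place → Set

  data AddClo (R : PRel) : MSet nS → MSet nS → Set where
    empty : AddClo R θ θ
    add   : ∀ {s₁ s₂ m₁ m₂} → R s₁ s₂ → AddClo R m₁ m₂ →
            AddClo R (⟦ s₁ ⟧ ⊕ m₁) (⟦ s₂ ⟧ ⊕ m₂)

  Enabled : MSet nS → Trans → Set
  Enabled m t = (pre t ⊆ m) × (∀ s → inh s t → lookup m s ≡ 0)

  fire : MSet nS → Trans → MSet nS
  fire m t = (m ⊖ pre t) ⊕ post t

  Match : PRel → MSet nS → MSet nS → Trans → Trans → Set
  Match R m₁ m₂ t₁ t₂ =
      AddClo R (pre t₁) (pre t₂)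
    × AddClo R (post t₁) (post t₂)
    × label t₁ ≡ label t₂
    × AddClo R (m₁ ⊖ pre t₁) (m₂ ⊖ pre t₂)
    × (∀ s s' → R s s' → (inh s t₁ ⇔ inh s' t₂))

  IsPTIPlaceBisim : PRel → Set
  IsPTIPlaceBisim R = ∀ m₁ m₂ → AddClo R m₁ m₂ →
      (∀ t₁ → Enabled m₁ t₁ → Σ Trans λ t₂ → Enabled m₂ t₂ × Match R m₁ m₂ t₁ t₂)
    × (∀ t₂ → Enabled m₂ t₂ → Σ Trans λ t₁ → Enabled m₁ t₁ × Match R m₁ m₂ t₁ t₂)

  IdRel : PRel
  IdRel s s' = s ≡ s'

  Inv : PRel → PRel
  Inv R s' s = R s s'

  Comp : PRel → PRel → PRel
  Comp R₁ R₂ s s'' = Σ Place λ s' → R₁ s s' × R₂ s' s''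

-- R^⊕ inherits reflexivity, inversion and composition from R, after which
-- conditions (a) and (b) transfer componentwise. Reflexivity holds because every
-- multiset is a sum of singletons (induction on its size). For composition, a
-- derivation of (⟦ s ⟧ ⊕ b , c) ∈ R^⊕ can be reordered to pair s off first:
-- ⊕ is cancellative, and a singleton ⟦ s ⟧ inside ⟦ u ⟧ ⊕ x with u ≢ s lies in x.
module Submission where

open import Defs
open import Data.Nat using (ℕ; zero; suc; _+_; _∸_; _≤_; _<_; z≤n; s≤s)
open import Data.Nat.Properties
  using (+-assoc; +-comm; +-cancelˡ-≡; m+[n∸m]≡n; 1+n≢0; suc-injective;
         m+n≡0⇒m≡0; m+n≡0⇒n≡0; +-commutativeSemigroup)
open import Algebra.Properties.CommutativeSemigroup +-commutativeSemigroup using (interchange)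
open import Data.Fin using (Fin; zero; suc)
open import Data.Fin.Properties using (_≟_)
import Data.Fin.Properties as Fin
open import Data.Vec using ([]; _∷_; lookup; sum)
open import Data.Vec.Properties
  using (lookup-zipWith; lookup-replicate; lookup∘tabulate; zipWith-assoc; zipWith-comm)
open import Data.Vec.Relation.Binary.Pointwise.Extensional using (ext; Pointwise-≡⇒≡)
open import Data.Product using (∃-syntax; _×_; _,_)
open import Data.Empty using (⊥-elim)
open import Function using (_∘_; _∋_)
import Function.Properties.Equivalence as ⇔
open import Relation.Binary.PropositionalEquality
open import Relation.Nullary using (yes; no)

module _ {n : ℕ} where

  lookup-ext : {u v : MSet n} → (∀ i → lookup u i ≡ lookup v i) → u ≡ v
  lookup-ext = Pointwise-≡⇒≡ ∘ ext

  lookup-⊕ : ∀ (a b : MSet n) i → lookup (a ⊕ b) i ≡ lookup a i + lookup b i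
  lookup-⊕ a b i = lookup-zipWith _+_ i a b

  lookup-⊖ : ∀ (a b : MSet n) i → lookup (a ⊖ b) i ≡ lookup a i ∸ lookup b i
  lookup-⊖ a b i = lookup-zipWith _∸_ i a b

  lookup-θ : ∀ i → lookup (θ {n}) i ≡ 0
  lookup-θ i = lookup-replicate i 0

  -- ⟦ s ⟧ tabulates a helper local to Defs; its entries are reached by
  -- rewriting with lookup∘tabulate, ascribed so that the helper is inferred.
  lookup-⟦⟧-self : ∀ s → lookup ⟦ s ⟧ s ≡ 1
  lookup-⟦⟧-self s
    rewrite (lookup ⟦ s ⟧ s ≡ _) ∋ lookup∘tabulate {n = n} _ s with s ≟ s
  ... | yes _  = refl
  ... | no s≢s = ⊥-elim (s≢s refl)

  lookup-⟦⟧-other : ∀ {s i} → s ≢ i → lookup ⟦ s ⟧ i ≡ 0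
  lookup-⟦⟧-other {s} {i} s≢i
    rewrite (lookup ⟦ s ⟧ i ≡ _) ∋ lookup∘tabulate {n = n} _ i with s ≟ i
  ... | yes s≡i = ⊥-elim (s≢i s≡i)
  ... | no _    = refl

  ⊕-assoc : ∀ (a b c : MSet n) → (a ⊕ b) ⊕ c ≡ a ⊕ (b ⊕ c)
  ⊕-assoc = zipWith-assoc +-assoc

  ⊕-comm : ∀ (a b : MSet n) → a ⊕ b ≡ b ⊕ a
  ⊕-comm = zipWith-comm +-comm

  ⊕-swap : ∀ (a b c : MSet n) → a ⊕ (b ⊕ c) ≡ b ⊕ (a ⊕ c)
  ⊕-swap a b c = begin
    a ⊕ (b ⊕ c)  ≡⟨ ⊕-assoc a b c ⟨
    (a ⊕ b) ⊕ c  ≡⟨ cong (_⊕ c) (⊕-comm a b) ⟩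
    (b ⊕ a) ⊕ c  ≡⟨ ⊕-assoc b a c ⟩
    b ⊕ (a ⊕ c)  ∎
    where open ≡-Reasoning

  ⊕-cancelˡ : ∀ (a : MSet n) {b c} → a ⊕ b ≡ a ⊕ c → b ≡ c
  ⊕-cancelˡ a {b} {c} eq = lookup-ext λ i → +-cancelˡ-≡ (lookup a i) _ _ (begin
    lookup a i + lookup b i  ≡⟨ lookup-⊕ a b i ⟨
    lookup (a ⊕ b) i         ≡⟨ cong (λ m → lookup m i) eq ⟩
    lookup (a ⊕ c) i         ≡⟨ lookup-⊕ a c i ⟩
    lookup a i + lookup c i  ∎)
    where open ≡-Reasoning

  ⊆⇒⊕-⊖ : ∀ {a m : MSet n} → a ⊆ m → a ⊕ (m ⊖ a) ≡ m
  ⊆⇒⊕-⊖ {a} {m} a⊆m = lookup-ext λ i → begin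
    lookup (a ⊕ (m ⊖ a)) i                  ≡⟨ lookup-⊕ a (m ⊖ a) i ⟩
    lookup a i + lookup (m ⊖ a) i           ≡⟨ cong (lookup a i +_) (lookup-⊖ m a i) ⟩
    lookup a i + (lookup m i ∸ lookup a i)  ≡⟨ m+[n∸m]≡n (a⊆m i) ⟩
    lookup m i                              ∎
    where open ≡-Reasoning

  ⟦⟧-⊆ : ∀ {s} {m : MSet n} → 0 < lookup m s → ⟦ s ⟧ ⊆ m
  ⟦⟧-⊆ {s} {m} 0<ms i with s ≟ i
  ... | yes refl = subst (_≤ lookup m i) (sym (lookup-⟦⟧-self s)) 0<ms
  ... | no s≢i   = subst (_≤ lookup m i) (sym (lookup-⟦⟧-other s≢i)) z≤n

  lookup-⟦⟧⊕-self : ∀ s (m : MSet n) → lookup (⟦ s ⟧ ⊕ m) s ≡ suc (lookup m s)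
  lookup-⟦⟧⊕-self s m = trans (lookup-⊕ ⟦ s ⟧ m s) (cong (_+ lookup m s) (lookup-⟦⟧-self s))

  ⟦⟧⊕≢θ : ∀ s (m : MSet n) → ⟦ s ⟧ ⊕ m ≢ θ
  ⟦⟧⊕≢θ s m eq =
    1+n≢0 (trans (sym (lookup-⟦⟧⊕-self s m)) (trans (cong (λ x → lookup x s) eq) (lookup-θ s)))

  ⟦⟧⊕-exchange : ∀ {u s} {x b : MSet n} → u ≢ s → ⟦ u ⟧ ⊕ x ≡ ⟦ s ⟧ ⊕ b →
                 ∃[ y ] x ≡ ⟦ s ⟧ ⊕ y × b ≡ ⟦ u ⟧ ⊕ y
  ⟦⟧⊕-exchange {u} {s} {x} {b} u≢s eq = x ⊖ ⟦ s ⟧ , x≡s⊕y , ⊕-cancelˡ ⟦ s ⟧ (begin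
    ⟦ s ⟧ ⊕ b            ≡⟨ eq ⟨
    ⟦ u ⟧ ⊕ x            ≡⟨ cong (⟦ u ⟧ ⊕_) x≡s⊕y ⟩
    ⟦ u ⟧ ⊕ (⟦ s ⟧ ⊕ y)  ≡⟨ ⊕-swap ⟦ u ⟧ ⟦ s ⟧ y ⟩
    ⟦ s ⟧ ⊕ (⟦ u ⟧ ⊕ y)  ∎)
    where
    open ≡-Reasoning
    y = x ⊖ ⟦ s ⟧
    0<xs : 0 < lookup x s
    0<xs = subst (0 <_) (begin
      suc (lookup b s)             ≡⟨ lookup-⟦⟧⊕-self s b ⟨
      lookup (⟦ s ⟧ ⊕ b) s         ≡⟨ cong (λ m → lookup m s) eq ⟨
      lookup (⟦ u ⟧ ⊕ x) s         ≡⟨ lookup-⊕ ⟦ u ⟧ x s ⟩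
      lookup ⟦ u ⟧ s + lookup x s  ≡⟨ cong (_+ lookup x s) (lookup-⟦⟧-other u≢s) ⟩
      lookup x s                   ∎) (s≤s z≤n)
    x≡s⊕y : x ≡ ⟦ s ⟧ ⊕ y
    x≡s⊕y = sym (⊆⇒⊕-⊖ (⟦⟧-⊆ {s} {x} 0<xs))

⟦zero⟧ : ∀ {n} → ⟦ zero {n} ⟧ ≡ 1 ∷ θ
⟦zero⟧ {n} = lookup-ext λ where
  zero    → lookup-⟦⟧-self {suc n} zero
  (suc i) → trans (lookup-⟦⟧-other {s = zero} {suc i} λ ()) (sym (lookup-θ i))

⟦suc⟧ : ∀ {n} (s : Fin n) → ⟦ suc s ⟧ ≡ 0 ∷ ⟦ s ⟧
⟦suc⟧ s = lookup-ext entry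
  where
  entry : ∀ i → lookup ⟦ suc s ⟧ i ≡ lookup (0 ∷ ⟦ s ⟧) i
  entry zero = lookup-⟦⟧-other {s = suc s} {zero} λ ()
  entry (suc i) with s ≟ i
  ... | yes refl = trans (lookup-⟦⟧-self (suc s)) (sym (lookup-⟦⟧-self s))
  ... | no s≢i   = trans (lookup-⟦⟧-other (s≢i ∘ Fin.suc-injective)) (sym (lookup-⟦⟧-other s≢i))

sum-θ : ∀ n → sum (θ {n}) ≡ 0
sum-θ zero    = refl
sum-θ (suc n) = sum-θ n

sum-⟦⟧ : ∀ {n} (s : Fin n) → sum ⟦ s ⟧ ≡ 1
sum-⟦⟧ {suc n} zero = trans (cong sum (⟦zero⟧ {n})) (cong suc (sum-θ n))
sum-⟦⟧ (suc s)      = trans (cong sum (⟦suc⟧ s)) (sum-⟦⟧ s)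

sum-⊕ : ∀ {n} (a b : MSet n) → sum (a ⊕ b) ≡ sum a + sum b
sum-⊕ []      []      = refl
sum-⊕ (x ∷ a) (y ∷ b) = trans (cong (x + y +_) (sum-⊕ a b)) (interchange x y (sum a) (sum b))

sum-⟦⟧⊕ : ∀ {n} (s : Fin n) (m : MSet n) → sum (⟦ s ⟧ ⊕ m) ≡ suc (sum m)
sum-⟦⟧⊕ s m = trans (sum-⊕ ⟦ s ⟧ m) (cong (_+ sum m) (sum-⟦⟧ s))

sum≡0⇒θ : ∀ {n} (m : MSet n) → sum m ≡ 0 → m ≡ θ
sum≡0⇒θ []      _  = refl
sum≡0⇒θ (x ∷ m) eq = cong₂ _∷_ (m+n≡0⇒m≡0 x eq) (sum≡0⇒θ m (m+n≡0⇒n≡0 x eq))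

sum≡suc⇒nonzero : ∀ {n k} (m : MSet n) → sum m ≡ suc k → ∃[ s ] 0 < lookup m s
sum≡suc⇒nonzero (zero  ∷ m) eq with sum≡suc⇒nonzero m eq
... | s , 0<ms = suc s , 0<ms
sum≡suc⇒nonzero (suc _ ∷ _) _ = zero , s≤s z≤n

module _ (N : PTINet) where
  open PTINet N

  AddClo-θ : ∀ {R a c} → AddClo N R a c → a ≡ θ → c ≡ θ
  AddClo-θ empty                     _   = refl
  AddClo-θ (add {s₁} {m₁ = m₁} _ _) a≡θ = ⊥-elim (⟦⟧⊕≢θ s₁ m₁ a≡θ)

  AddClo-pick : ∀ {R a c s b} → AddClo N R a c → a ≡ ⟦ s ⟧ ⊕ b →
                ∃[ s' ] ∃[ c' ] R s s' × c ≡ ⟦ s' ⟧ ⊕ c' × AddClo N R b c'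
  AddClo-pick {s = s} {b} empty θ≡s⊕b = ⊥-elim (⟦⟧⊕≢θ s b (sym θ≡s⊕b))
  AddClo-pick {R} {s = s} {b} (add {u} {v} {x} {c} r d) u⊕x≡s⊕b with u ≟ s
  ... | yes refl = v , c , r , refl , subst (λ z → AddClo N R z c) (⊕-cancelˡ ⟦ u ⟧ u⊕x≡s⊕b) d
  ... | no u≢s with ⟦⟧⊕-exchange u≢s u⊕x≡s⊕b
  ...   | y , x≡s⊕y , b≡u⊕y with AddClo-pick d x≡s⊕y
  ...     | s' , c' , r' , c≡s'⊕c' , d' =
    s' , ⟦ v ⟧ ⊕ c' , r' ,
    trans (cong (⟦ v ⟧ ⊕_) c≡s'⊕c') (⊕-swap ⟦ v ⟧ ⟦ s' ⟧ c') ,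
    subst (λ z → AddClo N R z (⟦ v ⟧ ⊕ c')) (sym b≡u⊕y) (add r d')

  AddClo-refl : ∀ {R} → (∀ s → R s s) → ∀ m → AddClo N R m m
  AddClo-refl {R} R-refl m = bySize (sum m) m refl
    where
    bySize : ∀ k m → sum m ≡ k → AddClo N R m m
    bySize zero m Σm≡0 = subst (λ z → AddClo N R z z) (sym (sum≡0⇒θ m Σm≡0)) empty
    bySize (suc k) m Σm≡1+k with sum≡suc⇒nonzero m Σm≡1+k
    ... | s , 0<ms = subst (λ z → AddClo N R z z) s⊕m'≡m (add (R-refl s) (bySize k m' Σm'≡k))
      where
      m' = m ⊖ ⟦ s ⟧
      s⊕m'≡m : ⟦ s ⟧ ⊕ m' ≡ m
      s⊕m'≡m = ⊆⇒⊕-⊖ (⟦⟧-⊆ {s = s} {m} 0<ms)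
      Σm'≡k : sum m' ≡ k
      Σm'≡k = suc-injective (trans (sym (sum-⟦⟧⊕ s m')) (trans (cong sum s⊕m'≡m) Σm≡1+k))

  AddClo-Id⇒≡ : ∀ {a b} → AddClo N (IdRel N) a b → a ≡ b
  AddClo-Id⇒≡ empty        = refl
  AddClo-Id⇒≡ (add refl d) = cong (⟦ _ ⟧ ⊕_) (AddClo-Id⇒≡ d)

  AddClo-Inv : ∀ {R a b} → AddClo N R a b → AddClo N (Inv N R) b a
  AddClo-Inv empty     = empty
  AddClo-Inv (add r d) = add r (AddClo-Inv d)

  AddClo-Comp : ∀ {R₁ R₂ a b c} → AddClo N R₁ a b → AddClo N R₂ b c →
                AddClo N (Comp N R₁ R₂) a c
  AddClo-Comp empty d₂ = subst (AddClo N _ θ) (sym (AddClo-θ d₂ refl)) empty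
  AddClo-Comp (add {s₂ = s₂} r₁ d₁) d₂ with AddClo-pick d₂ refl
  ... | s₃ , c' , r₂ , c≡s₃⊕c' , d₂' =
    subst (AddClo N _ _) (sym c≡s₃⊕c') (add (s₂ , r₁ , r₂) (AddClo-Comp d₁ d₂'))

  AddClo-Comp⁻ : ∀ {R₁ R₂ a c} → AddClo N (Comp N R₁ R₂) a c →
                 ∃[ b ] AddClo N R₁ a b × AddClo N R₂ b c
  AddClo-Comp⁻ empty = θ , empty , empty
  AddClo-Comp⁻ (add (s' , r₁ , r₂) d) with AddClo-Comp⁻ d
  ... | b , d₁ , d₂ = ⟦ s' ⟧ ⊕ b , add r₁ d₁ , add r₂ d₂

  Match-Id : ∀ m t → Match N (IdRel N) m m t t
  Match-Id m t = refl-Id (pre t) , refl-Id (post t) , refl , refl-Id (m ⊖ pre t) ,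
                 λ { s .s refl → ⇔.refl }
    where
    refl-Id : ∀ m → AddClo N (IdRel N) m m
    refl-Id = AddClo-refl λ _ → refl

  Match-Inv : ∀ {R m₁ m₂ t₁ t₂} → Match N R m₂ m₁ t₂ t₁ → Match N (Inv N R) m₁ m₂ t₁ t₂
  Match-Inv (pre-R , post-R , label≡ , rest-R , inh⇔) =
    AddClo-Inv pre-R , AddClo-Inv post-R , sym label≡ , AddClo-Inv rest-R ,
    λ s s' r → ⇔.sym (inh⇔ s' s r)

  Match-Comp : ∀ {R₁ R₂ m₁ m₂ m₃ t₁ t₂ t₃} →
               Match N R₁ m₁ m₂ t₁ t₂ → Match N R₂ m₂ m₃ t₂ t₃ → Match N (Comp N R₁ R₂) m₁ m₃ t₁ t₃
  Match-Comp (pre₁ , post₁ , label₁ , rest₁ , inh₁) (pre₂ , post₂ , label₂ , rest₂ , inh₂) =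
    AddClo-Comp pre₁ pre₂ , AddClo-Comp post₁ post₂ , trans label₁ label₂ , AddClo-Comp rest₁ rest₂ ,
    λ { s s'' (s' , r₁ , r₂) → ⇔.trans (inh₁ s s' r₁) (inh₂ s' s'' r₂) }

  IdRel-isBisim : IsPTIPlaceBisim N (IdRel N)
  IdRel-isBisim m₁ m₂ d with AddClo-Id⇒≡ d
  ... | refl = (λ t en → t , en , Match-Id m₁ t) , (λ t en → t , en , Match-Id m₁ t)

  Inv-isBisim : ∀ R → IsPTIPlaceBisim N R → IsPTIPlaceBisim N (Inv N R)
  Inv-isBisim R R-bisim m₁ m₂ d with R-bisim m₂ m₁ (AddClo-Inv d)
  ... | forth , back =
    (λ t₁ en₁ → let t₂ , en₂ , M = back t₁ en₁ in t₂ , en₂ , Match-Inv M) ,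
    (λ t₂ en₂ → let t₁ , en₁ , M = forth t₂ en₂ in t₁ , en₁ , Match-Inv M)

  Comp-isBisim : ∀ R₁ R₂ → IsPTIPlaceBisim N R₁ → IsPTIPlaceBisim N R₂ →
                 IsPTIPlaceBisim N (Comp N R₁ R₂)
  Comp-isBisim R₁ R₂ R₁-bisim R₂-bisim m₁ m₃ d with AddClo-Comp⁻ d
  ... | m₂ , d₁ , d₂ with R₁-bisim m₁ m₂ d₁ | R₂-bisim m₂ m₃ d₂
  ... | forth₁ , back₁ | forth₂ , back₂ =
    (λ t₁ en₁ → let t₂ , en₂ , M₁ = forth₁ t₁ en₁ ; t₃ , en₃ , M₂ = forth₂ t₂ en₂
                in t₃ , en₃ , Match-Comp M₁ M₂) ,
    (λ t₃ en₃ → let t₂ , en₂ , M₂ = back₂ t₃ en₃ ; t₁ , en₁ , M₁ = back₁ t₂ en₂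
                in t₁ , en₁ , Match-Comp M₁ M₂)

proposition31 : (N : PTINet) →
    IsPTIPlaceBisim N (IdRel N)
    × (∀ R → IsPTIPlaceBisim N R → IsPTIPlaceBisim N (Inv N R))
    × (∀ R₁ R₂ → IsPTIPlaceBisim N R₁ → IsPTIPlaceBisim N R₂ → IsPTIPlaceBisim N (Comp N R₁ R₂))
proposition31 N = IdRel-isBisim N , Inv-isBisim N , Comp-isBisim N
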